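{- Let $\mathcal{D}$ be a $2$-$(|\mathcal{P}|,r+1,\lambda)$ design with point set $\mathcal{P}$ (without repeated blocks), where $r>1$, admitting a group $G$ of automorphisms that is $2$-transitive on points and transitive on blocks. Then there is at most one feasible $G$-orbit on the set of flags of $\mathcal{D}$.
   Context: A flag is a pair $(\sigma,L)$ with $L$ a block and $\sigma\in L$. A $G$-orbit $\Omega$ on flags is feasible if (a) $|\Omega(\sigma)|\ge2$ for a point $\sigma$, where $\Omega(\sigma)$ is the set of flags in $\Omega$ with point $\sigma$, and (b) for a flag $(\sigma,L)\in\Omega$, the stabilizer $G_{\sigma,L}$ of $\sigma$ and of $L$ (setwise) is transitive on $L\setminus\{\sigma\}$. -}

module Defs where

open import Level using (_⊔_)
open import Data.Nat using (ℕ; suc)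
open import Data.Fin using (Fin)
open import Data.Fin.Subset using (Subset; _∈_; ∣_∣)
open import Data.Fin.Subset.Properties using (_∈?_)
open import Data.List using (List; length; filter)
open import Data.List.Membership.Propositional renaming (_∈_ to _∈ˡ_)
open import Data.List.Relation.Unary.Unique.Propositional using (Unique)
open import Data.Product using (Σ; ∃; _×_; _,_)
open import Relation.Nullary using (¬_)
open import Relation.Nullary.Decidable using (_×-dec_)
open import Relation.Binary.PropositionalEquality using (_≡_; _≢_)
open import Algebra.Bundles using (Group)

record Design (v k lam : ℕ) : Set where
  field
    blocks    : List (Subset v)
    noRepeats : Unique blocks
    blockSize : ∀ {L} → L ∈ˡ blocks → ∣ L ∣ ≡ k
    balanced  : ∀ (x y : Fin v) → x ≢ y →
                length (filter (λ L → (x ∈? L) ×-dec (y ∈? L)) blocks) ≡ lam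
open Design public

-- A faithful action of an abstract group G on the points Fin v
-- (so G is identified with a group of permutations of the points).
record Action {c ℓ} (G : Group c ℓ) (v : ℕ) : Set (c ⊔ ℓ) where
  open Group G
  field
    act      : Carrier → Fin v → Fin v
    act-ε    : ∀ x → act ε x ≡ x
    act-∙    : ∀ g h x → act (g ∙ h) x ≡ act g (act h x)
    act-≈    : ∀ {g h} → g ≈ h → ∀ x → act g x ≡ act h x
    faithful : ∀ {g h} → (∀ x → act g x ≡ act h x) → g ≈ h
open Action public

module _ {c ℓ} (G : Group c ℓ) {v k lam : ℕ} (D : Design v k lam) (A : Action G v) where
  open Group G using (Carrier)

  Maps : Carrier → Subset v → Subset v → Set
  Maps g L L' = ∀ x → (x ∈ L → act A g x ∈ L') × (act A g x ∈ L' → x ∈ L)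

  IsAutGroup : Set c
  IsAutGroup = ∀ g {L} → L ∈ˡ blocks D → ∃ λ L' → L' ∈ˡ blocks D × Maps g L L'

  PointTwoTransitive : Set c
  PointTwoTransitive = ∀ (x y x' y' : Fin v) → x ≢ y → x' ≢ y' →
    ∃ λ g → act A g x ≡ x' × act A g y ≡ y'

  BlockTransitive : Set c
  BlockTransitive = ∀ {L L'} → L ∈ˡ blocks D → L' ∈ˡ blocks D →
    ∃ λ g → Maps g L L'

  record Flag : Set where
    constructor flag
    field
      pt      : Fin v
      blk     : Subset v
      isBlock : blk ∈ˡ blocks D
      ptIn    : pt ∈ blk
  open Flag public

  SameOrbit : Flag → Flag → Set c
  SameOrbit F F' = ∃ λ g → act A g (pt F) ≡ pt F' × Maps g (blk F) (blk F')

  -- The G-orbit Ω of the flag F₀ is feasible: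
  -- (a) |Ω(σ)| ≥ 2 for a point σ, i.e. two distinct flags of Ω with point σ;
  -- (b) for a flag (σ,L) ∈ Ω, G_{σ,L} is transitive on L ∖ {σ}.
  Feasible : Flag → Set c
  Feasible F₀ =
    (∃ λ (σ : Fin v) → Σ Flag λ F₁ → Σ Flag λ F₂ →
        SameOrbit F₀ F₁ × SameOrbit F₀ F₂ ×
        pt F₁ ≡ σ × pt F₂ ≡ σ × blk F₁ ≢ blk F₂)
    ×
    (Σ Flag λ F → SameOrbit F₀ F ×
       (∀ x y → x ∈ blk F → y ∈ blk F → x ≢ pt F → y ≢ pt F →
          ∃ λ g → act A g (pt F) ≡ pt F × Maps g (blk F) (blk F) × act A g x ≡ y))

{-# OPTIONS --safe #-}
module Submission where

-- Conjugating by an element mapping one block onto another transports the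
-- condition "G_{σ,L} is transitive on L ∖ {σ}", so the two feasible orbits
-- give two points σ, τ of one block L with this property. If σ ≠ τ, the sets
-- L ∖ {σ} and L ∖ {τ} share a third point ρ because |L| ≥ 3, and moving
-- τ to ρ to σ shows that the setwise stabiliser G_L is transitive on L.

open import Defs
open import Algebra.Bundles using (Group)
open import Data.Bool using (true; false)
open import Data.Fin using (Fin; _≟_)
open import Data.Fin.Properties using (any?)
open import Data.Fin.Subset using (Subset; _∈_; ∣_∣; _∪_; ⁅_⁆; _⊆_)
open import Data.Fin.Subset.Properties
  using (_∈?_; x∈⁅x⁆; x∈p∪q⁺; p⊆q⇒∣p∣≤∣q∣; ∣⁅x⁆∣≡1)
open import Data.Nat using (ℕ; suc; _+_; _≤_; _<_; z≤n; s≤s)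
open import Data.Nat.Properties using (≤-trans; ≤-reflexive; n≤1+n; +-monoʳ-≤; +-suc; <⇒≱)
open import Data.Product using (∃; _×_; _,_; proj₁; proj₂)
open import Data.Sum using (inj₁; inj₂)
open import Data.Vec using ([]; _∷_)
open import Relation.Nullary using (yes; no)
open import Relation.Nullary.Decidable using (_×-dec_; ¬?)
open import Relation.Nullary.Negation using (contradiction)
open import Relation.Binary.PropositionalEquality
  using (_≡_; _≢_; refl; sym; trans; cong; cong₂; subst; module ≡-Reasoning)

∣p∪q∣≤∣p∣+∣q∣ : ∀ {n} (p q : Subset n) → ∣ p ∪ q ∣ ≤ ∣ p ∣ + ∣ q ∣
∣p∪q∣≤∣p∣+∣q∣ []          []          = z≤n
∣p∪q∣≤∣p∣+∣q∣ (true ∷ p)  (true ∷ q)  = s≤s (≤-trans (∣p∪q∣≤∣p∣+∣q∣ p q) (+-monoʳ-≤ ∣ p ∣ (n≤1+n ∣ q ∣)))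
∣p∪q∣≤∣p∣+∣q∣ (true ∷ p)  (false ∷ q) = s≤s (∣p∪q∣≤∣p∣+∣q∣ p q)
∣p∪q∣≤∣p∣+∣q∣ (false ∷ p) (true ∷ q)  = ≤-trans (s≤s (∣p∪q∣≤∣p∣+∣q∣ p q)) (≤-reflexive (sym (+-suc ∣ p ∣ ∣ q ∣)))
∣p∪q∣≤∣p∣+∣q∣ (false ∷ p) (false ∷ q) = ∣p∪q∣≤∣p∣+∣q∣ p q

∣⁅x⁆∪⁅y⁆∣≤2 : ∀ {n} (x y : Fin n) → ∣ ⁅ x ⁆ ∪ ⁅ y ⁆ ∣ ≤ 2
∣⁅x⁆∪⁅y⁆∣≤2 x y = ≤-trans (∣p∪q∣≤∣p∣+∣q∣ ⁅ x ⁆ ⁅ y ⁆) (≤-reflexive (cong₂ _+_ (∣⁅x⁆∣≡1 x) (∣⁅x⁆∣≡1 y)))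

∃-third-element : ∀ {n} {p : Subset n} → 2 < ∣ p ∣ → ∀ x y → ∃ λ z → z ∈ p × z ≢ x × z ≢ y
∃-third-element {p = p} 2<∣p∣ x y
  with any? (λ z → (z ∈? p) ×-dec (¬? (z ≟ x) ×-dec ¬? (z ≟ y)))
... | yes third = third
... | no ¬third = contradiction (≤-trans (p⊆q⇒∣p∣≤∣q∣ p⊆⁅x⁆∪⁅y⁆) (∣⁅x⁆∪⁅y⁆∣≤2 x y)) (<⇒≱ 2<∣p∣)
  where
  p⊆⁅x⁆∪⁅y⁆ : p ⊆ ⁅ x ⁆ ∪ ⁅ y ⁆
  p⊆⁅x⁆∪⁅y⁆ {z} z∈p with z ≟ x | z ≟ y
  ... | yes refl | _        = x∈p∪q⁺ (inj₁ (x∈⁅x⁆ z))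
  ... | no _     | yes refl = x∈p∪q⁺ (inj₂ (x∈⁅x⁆ z))
  ... | no z≢x   | no z≢y   = contradiction (z , z∈p , z≢x , z≢y) ¬third

module FlagOrbits {c ℓ} (G : Group c ℓ) {v k lam : ℕ} (D : Design v k lam) (A : Action G v) where
  open Group G using (Carrier; ε; _∙_; _⁻¹; inverseˡ; inverseʳ)
  open ≡-Reasoning

  private
    infixr 5 _·_
    _·_ : Carrier → Fin v → Fin v
    _·_ = act A

  ·-inverseˡ : ∀ g x → g ⁻¹ · g · x ≡ x
  ·-inverseˡ g x = trans (sym (act-∙ A (g ⁻¹) g x)) (trans (act-≈ A (inverseˡ g) x) (act-ε A x))

  ·-inverseʳ : ∀ g x → g · g ⁻¹ · x ≡ x
  ·-inverseʳ g x = trans (sym (act-∙ A g (g ⁻¹) x)) (trans (act-≈ A (inverseʳ g) x) (act-ε A x))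

  ⁻¹·-≢ : ∀ g {x y} → x ≢ g · y → g ⁻¹ · x ≢ y
  ⁻¹·-≢ g {x} x≢gy eq = x≢gy (trans (sym (·-inverseʳ g x)) (cong (act A g) eq))

  Maps-ε : ∀ {L} → Maps G D A ε L L
  Maps-ε {L} x = subst (_∈ L) (sym (act-ε A x)) , subst (_∈ L) (act-ε A x)

  Maps-∙ : ∀ {g h L L′ L″} → Maps G D A g L L′ → Maps G D A h L′ L″ → Maps G D A (h ∙ g) L L″
  Maps-∙ {g} {h} {L″ = L″} mg mh x =
    (λ x∈L → subst (_∈ L″) (sym (act-∙ A h g x)) (proj₁ (mh (g · x)) (proj₁ (mg x) x∈L))) ,
    (λ hgx∈L″ → proj₂ (mg x) (proj₂ (mh (g · x)) (subst (_∈ L″) (act-∙ A h g x) hgx∈L″)))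

  Maps-⁻¹ : ∀ {g L L′} → Maps G D A g L L′ → Maps G D A (g ⁻¹) L′ L
  Maps-⁻¹ {g} {L′ = L′} m x =
    (λ x∈L′ → proj₂ (m (g ⁻¹ · x)) (subst (_∈ L′) (sym (·-inverseʳ g x)) x∈L′)) ,
    (λ g⁻¹x∈L → subst (_∈ L′) (·-inverseʳ g x) (proj₁ (m (g ⁻¹ · x)) g⁻¹x∈L))

  SameOrbit-sym : ∀ {F F′} → SameOrbit G D A F F′ → SameOrbit G D A F′ F
  SameOrbit-sym {F} (g , gσ≡σ′ , m) =
    g ⁻¹ , trans (cong (act A (g ⁻¹)) (sym gσ≡σ′)) (·-inverseˡ g (pt F)) , Maps-⁻¹ m

  SameOrbit-trans : ∀ {F F′ F″} → SameOrbit G D A F F′ → SameOrbit G D A F′ F″ → SameOrbit G D A F F″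
  SameOrbit-trans {F} (g , gσ≡σ′ , mg) (h , hσ′≡σ″ , mh) =
    h ∙ g , trans (act-∙ A h g (pt F)) (trans (cong (act A h) gσ≡σ′) hσ′≡σ″) , Maps-∙ mg mh

  StabiliserTransitive : Fin v → Subset v → Set c
  StabiliserTransitive σ L = ∀ x y → x ∈ L → y ∈ L → x ≢ σ → y ≢ σ →
    ∃ λ g → g · σ ≡ σ × Maps G D A g L L × g · x ≡ y

  StabiliserTransitive-conj : ∀ {g σ L L′} → Maps G D A g L L′ →
    StabiliserTransitive σ L → StabiliserTransitive (g · σ) L′
  StabiliserTransitive-conj {g} {σ} m trans-σ x y x∈L′ y∈L′ x≢gσ y≢gσ =
    let m⁻¹ = Maps-⁻¹ m
        (h , hσ≡σ , mh , hx≡y) = trans-σ (g ⁻¹ · x) (g ⁻¹ · y)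
          (proj₁ (m⁻¹ x) x∈L′) (proj₁ (m⁻¹ y) y∈L′) (⁻¹·-≢ g x≢gσ) (⁻¹·-≢ g y≢gσ)
    in g ∙ (h ∙ g ⁻¹) ,
       (begin
         (g ∙ (h ∙ g ⁻¹)) · g · σ ≡⟨ conj-· h (g · σ) ⟩
         g · h · g ⁻¹ · g · σ     ≡⟨ cong (λ z → g · h · z) (·-inverseˡ g σ) ⟩
         g · h · σ                ≡⟨ cong (act A g) hσ≡σ ⟩
         g · σ                    ∎) ,
       Maps-∙ (Maps-∙ m⁻¹ mh) m ,
       (begin
         (g ∙ (h ∙ g ⁻¹)) · x     ≡⟨ conj-· h x ⟩
         g · h · g ⁻¹ · x         ≡⟨ cong (act A g) hx≡y ⟩
         g · g ⁻¹ · y             ≡⟨ ·-inverseʳ g y ⟩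
         y                        ∎)
    where
    conj-· : ∀ h z → (g ∙ (h ∙ g ⁻¹)) · z ≡ g · h · g ⁻¹ · z
    conj-· h z = trans (act-∙ A g (h ∙ g ⁻¹) z) (cong (act A g) (act-∙ A h (g ⁻¹) z))

  StabiliserTransitive⇒transitive : ∀ {L σ τ} → 2 < ∣ L ∣ → σ ∈ L → τ ∈ L →
    StabiliserTransitive σ L → StabiliserTransitive τ L →
    ∃ λ h → Maps G D A h L L × h · τ ≡ σ
  StabiliserTransitive⇒transitive {σ = σ} {τ} 2<∣L∣ σ∈L τ∈L trans-σ trans-τ with τ ≟ σ
  ... | yes refl = ε , Maps-ε , act-ε A τ
  ... | no τ≢σ =
    let (ρ , ρ∈L , ρ≢σ , ρ≢τ) = ∃-third-element 2<∣L∣ σ τ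
        (h₁ , _ , m₁ , h₁τ≡ρ) = trans-σ τ ρ τ∈L ρ∈L τ≢σ ρ≢σ
        (h₂ , _ , m₂ , h₂ρ≡σ) = trans-τ ρ σ ρ∈L σ∈L ρ≢τ (λ σ≡τ → τ≢σ (sym σ≡τ))
    in h₂ ∙ h₁ , Maps-∙ m₁ m₂ ,
       trans (act-∙ A h₂ h₁ τ) (trans (cong (act A h₂) h₁τ≡ρ) h₂ρ≡σ)

  StabiliserTransitive⇒SameOrbit : ∀ {g} (F F′ : Flag G D A) → 2 < ∣ blk F′ ∣ →
    Maps G D A g (blk F) (blk F′) →
    StabiliserTransitive (pt F) (blk F) → StabiliserTransitive (pt F′) (blk F′) →
    SameOrbit G D A F F′
  StabiliserTransitive⇒SameOrbit {g} F F′ 2<∣L′∣ m trans-σ trans-σ′ =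
    let (h , mh , hgσ≡σ′) = StabiliserTransitive⇒transitive 2<∣L′∣ (ptIn F′) (proj₁ (m (pt F)) (ptIn F))
                              trans-σ′ (StabiliserTransitive-conj m trans-σ)
    in h ∙ g , trans (act-∙ A h g (pt F)) hgσ≡σ′ , Maps-∙ m mh

lemma3p1 : ∀ {c ℓ} (G : Group c ℓ) (v r lam : ℕ) → 1 < r →
    (D : Design v (suc r) lam) (A : Action G v) →
    IsAutGroup G D A → PointTwoTransitive G D A → BlockTransitive G D A →
    (F₁ F₂ : Flag G D A) → Feasible G D A F₁ → Feasible G D A F₂ →
    SameOrbit G D A F₁ F₂
lemma3p1 G v r lam 1<r D A _ _ blockTransitive F₁ F₂ (_ , F , F₁∼F , trans-F) (_ , F′ , F₂∼F′ , trans-F′) =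
  SameOrbit-trans {F₁} {F} {F₂} F₁∼F
    (SameOrbit-trans {F} {F′} {F₂}
      (StabiliserTransitive⇒SameOrbit F F′ 2<∣L′∣ (proj₂ L↦L′) trans-F trans-F′)
      (SameOrbit-sym {F₂} {F′} F₂∼F′))
  where
  open FlagOrbits G D A

  L↦L′ : ∃ λ g → Maps G D A g (blk F) (blk F′)
  L↦L′ = blockTransitive (isBlock F) (isBlock F′)

  2<∣L′∣ : 2 < ∣ blk F′ ∣
  2<∣L′∣ = subst (2 <_) (sym (blockSize D (isBlock F′))) (s≤s 1<r)
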